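{- Let $G$ be a finite non-cyclic abelian group. Then there is no graph $\Gamma$ such that $\mathcal{P}(G)=L(\Gamma)$.
   Context: For a finite group $G$, the power graph $\mathcal{P}(G)$ is the simple graph with vertex set $G$ in which two distinct vertices $u,v$ are adjacent iff $u^m=v$ or $v^n=u$ for some positive integers $m,n$. $L(\Gamma)$ denotes the line graph of $\Gamma$: its vertices are the edges of $\Gamma$, two adjacent iff they share an endpoint. -}

module Defs where

open import Data.Nat using (ℕ; zero; suc)
open import Data.Integer using (ℤ; +_; -[1+_])
open import Data.Fin using (Fin; _<_)
open import Data.Bool using (Bool; true)
open import Data.Product using (Σ; ∃; ∃-syntax; _×_; _,_; proj₁; proj₂)
open import Data.Sum using (_⊎_)
open import Relation.Binary.PropositionalEquality using (_≡_; _≢_)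
open import Relation.Nullary using (¬_)
open import Function.Definitions using (Bijective)
open import Algebra.Structures using (IsAbelianGroup)

-- Finite abelian groups: an abelian group structure on the carrier Fin n
-- (every finite group is isomorphic to one of this form, and all notions
-- below are isomorphism invariant).

record FiniteAbelianGroup : Set₁ where
  field
    order : ℕ
    _∙_   : Fin order → Fin order → Fin order
    ε     : Fin order
    _⁻¹   : Fin order → Fin order
    isAbelianGroup : IsAbelianGroup _≡_ _∙_ ε _⁻¹

  Elt : Set
  Elt = Fin order

  powℕ : Elt → ℕ → Elt
  powℕ g zero    = ε
  powℕ g (suc m) = g ∙ powℕ g m

  powℤ : Elt → ℤ → Elt
  powℤ g (+ m)     = powℕ g m
  powℤ g -[1+ m ]  = (powℕ g (suc m)) ⁻¹

  IsCyclic : Set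
  IsCyclic = ∃[ g ] ((x : Elt) → ∃[ k ] powℤ g k ≡ x)

  PowerAdj : Elt → Elt → Set
  PowerAdj u v = u ≢ v ×
    ((∃[ m ] powℕ u (suc m) ≡ v) ⊎ (∃[ m ] powℕ v (suc m) ≡ u))

record SimpleGraph (k : ℕ) : Set where
  field
    adj    : Fin k → Fin k → Bool
    sym    : ∀ a b → adj a b ≡ adj b a
    irrefl : ∀ a → ¬ (adj a a ≡ true)

-- An edge {a,b} is represented uniquely by its endpoints with a < b.
Edge : ∀ {k} → SimpleGraph k → Set
Edge {k} Γ = Σ (Fin k × Fin k) λ p →
  (proj₁ p < proj₂ p) × (SimpleGraph.adj Γ (proj₁ p) (proj₂ p) ≡ true)

LineAdj : ∀ {k} (Γ : SimpleGraph k) → Edge Γ → Edge Γ → Set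
LineAdj Γ e f = e ≢ f ×
  (  (a ≡ c) ⊎ (a ≡ d) ⊎ (b ≡ c) ⊎ (b ≡ d))
  where
  a = proj₁ (proj₁ e)
  b = proj₂ (proj₁ e)
  c = proj₁ (proj₁ f)
  d = proj₂ (proj₁ f)

PowerGraphIsLineGraph : FiniteAbelianGroup → Set
PowerGraphIsLineGraph G =
  ∃[ k ] Σ (SimpleGraph k) λ Γ → Σ (Elt → Edge Γ) λ φ →
    Bijective _≡_ _≡_ φ ×
    (∀ u v → (PowerAdj u v → LineAdj Γ (φ u) (φ v)) ×
             (LineAdj Γ (φ u) (φ v) → PowerAdj u v))
  where open FiniteAbelianGroup G

-- In the power graph the identity is adjacent to every other element, so if P(G) = L(Γ)
-- then P(G), like every line graph, is claw-free, and no three elements of G can be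
-- pairwise non-adjacent, i.e. pairwise incomparable for "x is a power of y". But in a
-- non-cyclic group there are three such elements: take generators of maximal cyclic
-- subgroups. A maximal ⟨u₁⟩ is proper; an element outside it lies in a maximal
-- ⟨u₂⟩ ≠ ⟨u₁⟩; and a group is never the union of two subgroups neither of which
-- contains the other (u₁u₂ lies in neither), which yields a third maximal ⟨u₃⟩.
-- All elements are found inside the double-negation monad, which suffices since the
-- goal is a negation.
module Submission where

open import Defs
open import Algebra.Bundles using (Group)
open import Algebra.Structures using (IsAbelianGroup)
import Algebra.Properties.Group as GroupProperties
open import Data.Fin using (Fin; zero; suc; toℕ)
open import Data.Fin.Properties using (¬Fin0; pigeonhole; injective⇒≤; sequence)
open import Data.Integer using (+_)
open import Data.Nat using (ℕ; zero; suc; _+_; _*_; _<_)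
open import Data.Nat.Properties
  using (+-suc; +-identityʳ; *-zeroʳ; *-suc; m≤n⇒∃[o]m+o≡n; ≤-refl; <⇒≱)
open import Data.Product using (∃; ∃-syntax; _×_; _,_; proj₁; proj₂)
open import Data.Sum using (_⊎_; inj₁; inj₂)
open import Data.Vec.Functional using (_∷_)
open import Effect.Monad using (RawMonad)
open import Level using (0ℓ)
open import Function.Definitions using (Injective)
open import Relation.Binary.PropositionalEquality
open import Relation.Nullary.Negation using (¬_; ¬¬-Monad; contradiction; contraposition)

open RawMonad (¬¬-Monad {0ℓ}) using (_>>=_; pure; rawApplicative)

¬∀⇒¬¬∃¬ : ∀ {n} {P : Fin n → Set} → ¬ (∀ i → P i) → ¬ ¬ ∃ λ i → ¬ P i
¬∀⇒¬¬∃¬ ¬∀P ¬∃¬P = sequence rawApplicative (λ i ¬Pi → ¬∃¬P (i , ¬Pi)) ¬∀P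

module CyclicSubgroups (G : FiniteAbelianGroup) where
  open FiniteAbelianGroup G
  open IsAbelianGroup isAbelianGroup using (isGroup; assoc; identityˡ; identityʳ; inverseˡ; inverseʳ)

  group : Group _ _
  group = record { Carrier = Elt ; _≈_ = _≡_ ; _∙_ = _∙_ ; ε = ε ; _⁻¹ = _⁻¹ ; isGroup = isGroup }

  open GroupProperties group using (identityʳ-unique; inverseʳ-unique)

  powℕ-+ : ∀ g a b → powℕ g (a + b) ≡ powℕ g a ∙ powℕ g b
  powℕ-+ g zero    b = sym (identityˡ _)
  powℕ-+ g (suc a) b = trans (cong (g ∙_) (powℕ-+ g a b)) (sym (assoc _ _ _))

  powℕ-* : ∀ g a b → powℕ (powℕ g a) b ≡ powℕ g (a * b)
  powℕ-* g a zero    = cong (powℕ g) (sym (*-zeroʳ a))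
  powℕ-* g a (suc b) = begin
    powℕ g a ∙ powℕ (powℕ g a) b  ≡⟨ cong (powℕ g a ∙_) (powℕ-* g a b) ⟩
    powℕ g a ∙ powℕ g (a * b)     ≡⟨ powℕ-+ g a (a * b) ⟨
    powℕ g (a + a * b)            ≡⟨ cong (powℕ g) (*-suc a b) ⟨
    powℕ g (a * suc b)            ∎
    where open ≡-Reasoning

  -- Two of the powers g⁰, …, g^order coincide, say gⁱ = gⁱ⁺¹⁺ᵏ, and then g¹⁺ᵏ = ε.
  finiteOrder : ∀ g → ∃[ k ] powℕ g (suc k) ≡ ε
  finiteOrder g with pigeonhole ≤-refl (λ (i : Fin (suc order)) → powℕ g (toℕ i))
  ... | i , j , i<j , gⁱ≡gʲ with m≤n⇒∃[o]m+o≡n i<j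
  ... | k , i+1+k≡j = k , identityʳ-unique (powℕ g (toℕ i)) (powℕ g (suc k)) (begin
    powℕ g (toℕ i) ∙ powℕ g (suc k)  ≡⟨ powℕ-+ g (toℕ i) (suc k) ⟨
    powℕ g (toℕ i + suc k)           ≡⟨ cong (powℕ g) (trans (+-suc (toℕ i) k) i+1+k≡j) ⟩
    powℕ g (toℕ j)                   ≡⟨ gⁱ≡gʲ ⟨
    powℕ g (toℕ i)                   ∎)
    where open ≡-Reasoning

  -- Positive exponents suffice because every element has finite order.
  infix 4 _∈⟨_⟩
  _∈⟨_⟩ : Elt → Elt → Set
  x ∈⟨ h ⟩ = ∃[ m ] powℕ h (suc m) ≡ x

  ∈⟨⟩-refl : ∀ h → h ∈⟨ h ⟩
  ∈⟨⟩-refl h = 0 , identityʳ h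

  ∈⟨⟩-trans : ∀ {x y z} → x ∈⟨ y ⟩ → y ∈⟨ z ⟩ → x ∈⟨ z ⟩
  ∈⟨⟩-trans {z = z} (a , zᵃ≡x) (b , zᵇ≡y) = a + b * suc a ,
    trans (sym (powℕ-* z (suc b) (suc a))) (trans (cong (λ w → powℕ w (suc a)) zᵇ≡y) zᵃ≡x)

  ε∈⟨⟩ : ∀ h → ε ∈⟨ h ⟩
  ε∈⟨⟩ = finiteOrder

  ⁻¹∈⟨⟩ : ∀ h → h ⁻¹ ∈⟨ h ⟩
  ⁻¹∈⟨⟩ h with finiteOrder h
  ... | k , hᵏ⁺¹≡ε = k + k , (begin
    powℕ h (suc (k + k))        ≡⟨ cong (powℕ h) (+-suc k k) ⟨
    powℕ h (k + suc k)          ≡⟨ powℕ-+ h k (suc k) ⟩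
    powℕ h k ∙ powℕ h (suc k)   ≡⟨ cong (powℕ h k ∙_) hᵏ⁺¹≡ε ⟩
    powℕ h k ∙ ε                ≡⟨ identityʳ _ ⟩
    powℕ h k                    ≡⟨ inverseʳ-unique h (powℕ h k) hᵏ⁺¹≡ε ⟩
    h ⁻¹                        ∎)
    where open ≡-Reasoning

  ∙∈⟨⟩ : ∀ {x y h} → x ∈⟨ h ⟩ → y ∈⟨ h ⟩ → x ∙ y ∈⟨ h ⟩
  ∙∈⟨⟩ {h = h} (a , hᵃ≡x) (b , hᵇ≡y) = a + suc b ,
    trans (powℕ-+ h (suc a) (suc b)) (cong₂ _∙_ hᵃ≡x hᵇ≡y)

  ∙∉⟨⟩ˡ : ∀ {a b} → ¬ b ∈⟨ a ⟩ → ¬ a ∙ b ∈⟨ a ⟩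
  ∙∉⟨⟩ˡ {a} {b} b∉⟨a⟩ ab∈⟨a⟩ = b∉⟨a⟩ (subst (_∈⟨ a ⟩) a⁻¹ab≡b (∙∈⟨⟩ (⁻¹∈⟨⟩ a) ab∈⟨a⟩))
    where
    a⁻¹ab≡b : (a ⁻¹) ∙ (a ∙ b) ≡ b
    a⁻¹ab≡b = trans (sym (assoc _ _ _)) (trans (cong (_∙ b) (inverseˡ a)) (identityˡ b))

  ∙∉⟨⟩ʳ : ∀ {a b} → ¬ a ∈⟨ b ⟩ → ¬ a ∙ b ∈⟨ b ⟩
  ∙∉⟨⟩ʳ {a} {b} a∉⟨b⟩ ab∈⟨b⟩ = a∉⟨b⟩ (subst (_∈⟨ b ⟩) abb⁻¹≡a (∙∈⟨⟩ ab∈⟨b⟩ (⁻¹∈⟨⟩ b)))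
    where
    abb⁻¹≡a : (a ∙ b) ∙ (b ⁻¹) ≡ a
    abb⁻¹≡a = trans (assoc _ _ _) (trans (cong (a ∙_) (inverseʳ b)) (identityʳ a))

  Incomparable : Elt → Elt → Set
  Incomparable u v = ¬ u ∈⟨ v ⟩ × ¬ v ∈⟨ u ⟩

  incomparable⇒¬covers : ∀ {a b} → Incomparable a b → ¬ (∀ x → x ∈⟨ a ⟩ ⊎ x ∈⟨ b ⟩)
  incomparable⇒¬covers {a} {b} (a∉⟨b⟩ , b∉⟨a⟩) covers with covers (a ∙ b)
  ... | inj₁ ab∈⟨a⟩ = ∙∉⟨⟩ˡ b∉⟨a⟩ ab∈⟨a⟩
  ... | inj₂ ab∈⟨b⟩ = ∙∉⟨⟩ʳ a∉⟨b⟩ ab∈⟨b⟩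

  ¬cyclic⇒¬generates : ¬ IsCyclic → ∀ g → ¬ (∀ x → x ∈⟨ g ⟩)
  ¬cyclic⇒¬generates ¬cyclic g generates =
    ¬cyclic (g , λ x → + suc (proj₁ (generates x)) , proj₂ (generates x))

  -- u generates a maximal cyclic subgroup (classically: ⟨u⟩ ⊆ ⟨h⟩ implies ⟨u⟩ = ⟨h⟩).
  Maximal : Elt → Set
  Maximal u = ∀ h → u ∈⟨ h ⟩ → ¬ ¬ h ∈⟨ u ⟩

  maximal⇒incomparable : ∀ {u v z} → Maximal u → z ∈⟨ v ⟩ → ¬ z ∈⟨ u ⟩ → Incomparable u v
  maximal⇒incomparable {u} {v} u-max z∈⟨v⟩ z∉⟨u⟩ = (λ u∈⟨v⟩ → u-max v u∈⟨v⟩ v∉⟨u⟩) , v∉⟨u⟩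
    where
    v∉⟨u⟩ : ¬ v ∈⟨ u ⟩
    v∉⟨u⟩ v∈⟨u⟩ = z∉⟨u⟩ (∈⟨⟩-trans z∈⟨v⟩ v∈⟨u⟩)

  -- A strictly ascending chain of cyclic subgroups below ⟨u⟩ is recorded by the injective
  -- family c of their generators; its length m is at most order, which bounds the ascent.
  maximal-above-chain : ∀ fuel m (c : Fin m → Elt) → Injective _≡_ _≡_ c →
    ∀ u → (∀ i → c i ∈⟨ u ⟩) → order < m + fuel → ¬ ¬ (∃[ v ] u ∈⟨ v ⟩ × Maximal v)
  maximal-above-chain zero m c c-inj u c∈⟨u⟩ bound =
    contradiction (injective⇒≤ c-inj) (<⇒≱ (subst (order <_) (+-identityʳ m) bound))
  maximal-above-chain (suc fuel) m c c-inj u c∈⟨u⟩ bound ¬maximal-above =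
    ¬maximal-above (u , ∈⟨⟩-refl u , u-max)
    where
    u-max : Maximal u
    u-max h u∈⟨h⟩ h∉⟨u⟩ = maximal-above-chain fuel (suc m) (h ∷ c) hc-inj h hc∈⟨h⟩
      (subst (order <_) (+-suc m fuel) bound)
      (λ (v , h∈⟨v⟩ , v-max) → ¬maximal-above (v , ∈⟨⟩-trans u∈⟨h⟩ h∈⟨v⟩ , v-max))
      where
      hc∈⟨h⟩ : ∀ i → (h ∷ c) i ∈⟨ h ⟩
      hc∈⟨h⟩ zero    = ∈⟨⟩-refl h
      hc∈⟨h⟩ (suc i) = ∈⟨⟩-trans (c∈⟨u⟩ i) u∈⟨h⟩

      h≢c : ∀ i → h ≢ c i
      h≢c i refl = h∉⟨u⟩ (c∈⟨u⟩ i)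

      hc-inj : Injective _≡_ _≡_ (h ∷ c)
      hc-inj {zero}  {zero}  _   = refl
      hc-inj {zero}  {suc j} h≡c = contradiction h≡c (h≢c j)
      hc-inj {suc i} {zero}  c≡h = contradiction (sym c≡h) (h≢c i)
      hc-inj {suc i} {suc j} c≡c = cong suc (c-inj c≡c)

  maximal-above : ∀ x → ¬ ¬ (∃[ u ] x ∈⟨ u ⟩ × Maximal u)
  maximal-above x = maximal-above-chain (suc order) 0 (λ ()) (λ {i} → contradiction i ¬Fin0) x (λ ()) ≤-refl

  IncomparableTriple : Set
  IncomparableTriple = ∃[ u₁ ] ∃[ u₂ ] ∃[ u₃ ]
    Incomparable u₁ u₂ × Incomparable u₁ u₃ × Incomparable u₂ u₃

  ¬cyclic⇒incomparableTriple : ¬ IsCyclic → ¬ ¬ IncomparableTriple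
  ¬cyclic⇒incomparableTriple ¬cyclic = do
    (u₁ , _ , u₁-max) ← maximal-above ε
    (x , x∉⟨u₁⟩) ← ¬∀⇒¬¬∃¬ (¬cyclic⇒¬generates ¬cyclic u₁)
    (u₂ , x∈⟨u₂⟩ , u₂-max) ← maximal-above x
    let u₁∥u₂ = maximal⇒incomparable u₁-max x∈⟨u₂⟩ x∉⟨u₁⟩
    (y , y∉⟨u₁⟩∪⟨u₂⟩) ← ¬∀⇒¬¬∃¬ (incomparable⇒¬covers u₁∥u₂)
    (u₃ , y∈⟨u₃⟩ , _) ← maximal-above y
    pure (u₁ , u₂ , u₃ , u₁∥u₂
         , maximal⇒incomparable u₁-max y∈⟨u₃⟩ (λ y∈⟨u₁⟩ → y∉⟨u₁⟩∪⟨u₂⟩ (inj₁ y∈⟨u₁⟩))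
         , maximal⇒incomparable u₂-max y∈⟨u₃⟩ (λ y∈⟨u₂⟩ → y∉⟨u₁⟩∪⟨u₂⟩ (inj₂ y∈⟨u₂⟩)))

ClawFree : {A : Set} → (A → A → Set) → Set
ClawFree R = ∀ {e f g h} → f ≢ g → f ≢ h → g ≢ h →
  R e f → R e g → R e h → R f g ⊎ R f h ⊎ R g h

clawFree-embedding : {A B : Set} {R : A → A → Set} {S : B → B → Set} {φ : A → B} →
  Injective _≡_ _≡_ φ → (∀ a b → R a b → S (φ a) (φ b)) → (∀ a b → S (φ a) (φ b) → R a b) →
  ClawFree S → ClawFree R
clawFree-embedding φ-inj R⇒S S⇒R S-clawFree {e} {f} {g} {h} f≢g f≢h g≢h ef eg eh
  with S-clawFree (contraposition φ-inj f≢g) (contraposition φ-inj f≢h) (contraposition φ-inj g≢h)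
                  (R⇒S e f ef) (R⇒S e g eg) (R⇒S e h eh)
... | inj₁ fg        = inj₁ (S⇒R f g fg)
... | inj₂ (inj₁ fh) = inj₂ (inj₁ (S⇒R f h fh))
... | inj₂ (inj₂ gh) = inj₂ (inj₂ (S⇒R g h gh))

module _ {k : ℕ} (Γ : SimpleGraph k) where

  private
    _∋_ : Edge Γ → Fin k → Set
    f ∋ w = (w ≡ proj₁ (proj₁ f)) ⊎ (w ≡ proj₂ (proj₁ f))

    sharedEndpoint : ∀ e f → LineAdj Γ e f → f ∋ proj₁ (proj₁ e) ⊎ f ∋ proj₂ (proj₁ e)
    sharedEndpoint e f (_ , inj₁ p)                 = inj₁ (inj₁ p)
    sharedEndpoint e f (_ , inj₂ (inj₁ p))          = inj₁ (inj₂ p)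
    sharedEndpoint e f (_ , inj₂ (inj₂ (inj₁ p)))   = inj₂ (inj₁ p)
    sharedEndpoint e f (_ , inj₂ (inj₂ (inj₂ p)))   = inj₂ (inj₂ p)

    commonEndpoint⇒lineAdj : ∀ {w} f g → f ≢ g → f ∋ w → g ∋ w → LineAdj Γ f g
    commonEndpoint⇒lineAdj f g f≢g (inj₁ p) (inj₁ q) = f≢g , inj₁ (trans (sym p) q)
    commonEndpoint⇒lineAdj f g f≢g (inj₁ p) (inj₂ q) = f≢g , inj₂ (inj₁ (trans (sym p) q))
    commonEndpoint⇒lineAdj f g f≢g (inj₂ p) (inj₁ q) = f≢g , inj₂ (inj₂ (inj₁ (trans (sym p) q)))
    commonEndpoint⇒lineAdj f g f≢g (inj₂ p) (inj₂ q) = f≢g , inj₂ (inj₂ (inj₂ (trans (sym p) q)))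

  -- Each of f, g, h contains one of the two endpoints of e, so two of them share one.
  lineGraph-clawFree : ClawFree (LineAdj Γ)
  lineGraph-clawFree {e} {f} {g} {h} f≢g f≢h g≢h ef eg eh
    with sharedEndpoint e f ef | sharedEndpoint e g eg | sharedEndpoint e h eh
  ... | inj₁ p | inj₁ q | _      = inj₁ (commonEndpoint⇒lineAdj f g f≢g p q)
  ... | inj₂ p | inj₂ q | _      = inj₁ (commonEndpoint⇒lineAdj f g f≢g p q)
  ... | inj₁ p | inj₂ _ | inj₁ r = inj₂ (inj₁ (commonEndpoint⇒lineAdj f h f≢h p r))
  ... | inj₂ p | inj₁ _ | inj₂ r = inj₂ (inj₁ (commonEndpoint⇒lineAdj f h f≢h p r))
  ... | inj₁ _ | inj₂ q | inj₂ r = inj₂ (inj₂ (commonEndpoint⇒lineAdj g h g≢h q r))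
  ... | inj₂ _ | inj₁ q | inj₁ r = inj₂ (inj₂ (commonEndpoint⇒lineAdj g h g≢h q r))

module PowerGraph (G : FiniteAbelianGroup) where
  open FiniteAbelianGroup G
  open CyclicSubgroups G

  incomparable⇒≢ : ∀ {u v} → Incomparable u v → u ≢ v
  incomparable⇒≢ {u} (u∉⟨v⟩ , _) refl = u∉⟨v⟩ (∈⟨⟩-refl u)

  incomparable⇒¬adj : ∀ {u v} → Incomparable u v → ¬ PowerAdj u v
  incomparable⇒¬adj (_ , v∉⟨u⟩) (_ , inj₁ v∈⟨u⟩) = v∉⟨u⟩ v∈⟨u⟩
  incomparable⇒¬adj (u∉⟨v⟩ , _) (_ , inj₂ u∈⟨v⟩) = u∉⟨v⟩ u∈⟨v⟩

  ∉⟨⟩⇒ε-adj : ∀ {u v} → ¬ u ∈⟨ v ⟩ → PowerAdj ε u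
  ∉⟨⟩⇒ε-adj {u} {v} u∉⟨v⟩ = (λ ε≡u → u∉⟨v⟩ (subst (_∈⟨ v ⟩) ε≡u (ε∈⟨⟩ v))) , inj₂ (ε∈⟨⟩ u)

  incomparableTriple⇒¬clawFree : IncomparableTriple → ¬ ClawFree PowerAdj
  incomparableTriple⇒¬clawFree (u₁ , u₂ , u₃ , u₁∥u₂ , u₁∥u₃ , u₂∥u₃) clawFree
    with clawFree (incomparable⇒≢ u₁∥u₂) (incomparable⇒≢ u₁∥u₃) (incomparable⇒≢ u₂∥u₃)
           (∉⟨⟩⇒ε-adj (proj₁ u₁∥u₂)) (∉⟨⟩⇒ε-adj (proj₂ u₁∥u₂)) (∉⟨⟩⇒ε-adj (proj₂ u₁∥u₃))
  ... | inj₁ adj₁₂        = incomparable⇒¬adj u₁∥u₂ adj₁₂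
  ... | inj₂ (inj₁ adj₁₃) = incomparable⇒¬adj u₁∥u₃ adj₁₃
  ... | inj₂ (inj₂ adj₂₃) = incomparable⇒¬adj u₂∥u₃ adj₂₃

mainTheorem8 : (G : FiniteAbelianGroup) → ¬ FiniteAbelianGroup.IsCyclic G → ¬ PowerGraphIsLineGraph G
mainTheorem8 G ¬cyclic (_ , Γ , _ , (φ-inj , _) , φ-iso) =
  CyclicSubgroups.¬cyclic⇒incomparableTriple G ¬cyclic λ triple →
    PowerGraph.incomparableTriple⇒¬clawFree G triple
      (clawFree-embedding φ-inj (λ u v → proj₁ (φ-iso u v)) (λ u v → proj₂ (φ-iso u v))
        (lineGraph-clawFree Γ))
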